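{- Let $\mathcal T=(3,4,6,4)$ be the semi-regular edge-to-edge tessellation of the plane (the rhombitrihexagonal tiling) in which every vertex is surrounded, in cyclic order, by an equilateral triangle, a square, a regular hexagon and a square. Then its half-domination density satisfies $$\rho_{(3,4,6,4)}\le \frac{19}{30}.$$
   Context: The tessellation $\mathcal T=(3,4,6,4)$ is periodic: a minimal cluster consisting of one regular hexagon, three squares and two equilateral triangles (all with the same side length), translated by all integer combinations of two vectors $v_1,v_2$, tiles the plane edge-to-edge. For $m,n\in\mathbb N$, let $G_{\mathcal T,m,n}$ be the graph whose vertices are the tiles of the region formed by $m$ copies of the minimal cluster in the direction $v_1$ and $n$ copies in the direction $v_2$ (i.e. translates by $a v_1+b v_2$, $0\le a<m$, $0\le b<n$), two tiles being adjacent iff they share a common edge. For a vertex $v$ let $d(v)$ be its degree. A set $S$ of vertices is half-dependent if every $v\in S$ has at most $\lfloor d(v)/2\rfloor$ neighbors in $S$. Let $\rho_{\mathcal T,m,n}$ be the maximum cardinality of a half-dependent set in $G_{\mathcal T,m,n}$ divided by the number of vertices of $G_{\mathcal T,m,n}$, and define the half-domination density $\rho_{\mathcal T}=\limsup_{m,n\to\infty}\rho_{\mathcal T,m,n}$. -}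

module Defs where

open import Data.Nat using (ℕ; zero; suc; _+_; _*_; _≤_; _/_; _≡ᵇ_)
open import Data.Bool using (Bool; true; false; _∧_; _∨_; if_then_else_)
open import Data.Fin using (Fin; toℕ)
open import Data.List using (List; []; _∷_; length; filter; map; concatMap; allFin; cartesianProduct)
open import Data.Product using (_×_; _,_)
open import Relation.Binary.PropositionalEquality using (_≡_)

-- Hexagons sit at the points (a,b) of the triangular lattice spanned by v₁,v₂.
-- The minimal cluster at (a,b) consists of:
--   hex  : the hexagon H(a,b)
--   sq₁  : the square on the lattice edge (a,b)–(a+1,b)
--   sq₂  : the square on the lattice edge (a,b)–(a,b+1)
--   sq₃  : the square on the lattice edge (a+1,b)–(a,b+1)
--   up   : the triangle in the lattice triangle (a,b),(a+1,b),(a,b+1)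
--   down : the triangle in the lattice triangle (a+1,b),(a,b+1),(a+1,b+1)
data Kind : Set where
  hex sq₁ sq₂ sq₃ up down : Kind

kinds : List Kind
kinds = hex ∷ sq₁ ∷ sq₂ ∷ sq₃ ∷ up ∷ down ∷ []

-- E k a b k' c d : tile (k,a,b) shares an edge with tile (k',c,d)
-- (each edge of the tiling listed once, from hexagon/triangle side to square side).
E : Kind → ℕ → ℕ → Kind → ℕ → ℕ → Bool
E hex a b sq₁ c d = ((a ≡ᵇ c) ∧ (b ≡ᵇ d)) ∨ ((a ≡ᵇ suc c) ∧ (b ≡ᵇ d))
E hex a b sq₂ c d = ((a ≡ᵇ c) ∧ (b ≡ᵇ d)) ∨ ((a ≡ᵇ c) ∧ (b ≡ᵇ suc d))
E hex a b sq₃ c d = ((a ≡ᵇ suc c) ∧ (b ≡ᵇ d)) ∨ ((a ≡ᵇ c) ∧ (b ≡ᵇ suc d))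
E up a b sq₁ c d = (a ≡ᵇ c) ∧ (b ≡ᵇ d)
E up a b sq₂ c d = (a ≡ᵇ c) ∧ (b ≡ᵇ d)
E up a b sq₃ c d = (a ≡ᵇ c) ∧ (b ≡ᵇ d)
E down a b sq₃ c d = (a ≡ᵇ c) ∧ (b ≡ᵇ d)
E down a b sq₂ c d = (c ≡ᵇ suc a) ∧ (d ≡ᵇ b)
E down a b sq₁ c d = (c ≡ᵇ a) ∧ (d ≡ᵇ suc b)
E _ _ _ _ _ _ = false

-- Vertices of G_{T,m,n}: tiles of the clusters translated by a v₁ + b v₂, a < m, b < n.
Vertex : ℕ → ℕ → Set
Vertex m n = Kind × Fin m × Fin n

vertices : (m n : ℕ) → List (Vertex m n)
vertices m n = cartesianProduct kinds (cartesianProduct (allFin m) (allFin n))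

adj : ∀ {m n} → Vertex m n → Vertex m n → Bool
adj (k , a , b) (k' , c , d) =
  E k (toℕ a) (toℕ b) k' (toℕ c) (toℕ d) ∨ E k' (toℕ c) (toℕ d) k (toℕ a) (toℕ b)

count : ∀ {m n} → (Vertex m n → Bool) → ℕ
count {m} {n} P = length (filter (λ v → P v Data.Bool.≟ true) (vertices m n))
  where import Data.Bool

deg : ∀ {m n} → Vertex m n → ℕ
deg v = count (λ u → adj u v)

nbrsIn : ∀ {m n} → (Vertex m n → Bool) → Vertex m n → ℕ
nbrsIn S v = count (λ u → S u ∧ adj u v)

HalfDependent : ∀ {m n} → (Vertex m n → Bool) → Set
HalfDependent {m} {n} S = ∀ (v : Vertex m n) → S v ≡ true → nbrsIn S v ≤ deg v / 2

-- Give the tiles weights w(hexagon) = 2, w(square) = 4, w(triangle) = 9, and let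
-- every selected tile u send across each of its edges uv the charge w(v), plus w(u) when v is
-- not selected. A selected tile has at most ⌊d/2⌋ selected neighbours, and the weights are tuned
-- so that it then sends at least 30. The two charges across an edge uv add up to at most
-- w(u) + w(v), and every cluster of six tiles owns twelve edges of total weight 114. Hence
-- 30 |S| ≤ 114 (m + 2)(n + 2), where the extra rows and columns absorb the edges leaving the
-- window; once m and n are large compared with k this boundary term is swallowed by the slack
-- between 19/30 and 19/30 + 1/(k + 1).
module Submission where

open import Defs
open import Data.Bool using (Bool; true; false; _∧_; _∨_; T)
import Data.Bool as Bool
open import Data.Bool.Properties using (∧-zeroʳ; ∧-identityʳ; ∧-assoc; ∨-identityʳ)
open import Data.Empty using (⊥-elim)
open import Data.Fin using (Fin; toℕ) renaming (zero to fzero; suc to fsuc)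
open import Data.Fin.Properties using (toℕ<n)
open import Data.List
  using (List; []; _∷_; _++_; _∷ʳ_; foldr; length; filter; map; upTo; allFin; cartesianProduct)
open import Data.List.Properties using (map-upTo; upTo-∷ʳ; map-tabulate; length-tabulate; length-upTo)
open import Data.Nat using (ℕ; zero; suc; _+_; _*_; _∸_; _≤_; _/_; _≡ᵇ_; z≤n; s≤s)
open import Data.Nat.DivMod using (/-monoˡ-≤)
open import Data.Nat.Properties
open import Algebra.Properties.CommutativeSemigroup +-commutativeSemigroup using (interchange)
open import Data.Nat.Tactic.RingSolver using (solve-∀)
open import Data.Product using (Σ; _×_; _,_; proj₁; proj₂)
open import Data.Sum using (_⊎_; inj₁; inj₂)
open import Function using (_∘_)
open import Relation.Binary.PropositionalEquality
open import Relation.Nullary using (¬_)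

private
  variable
    A B : Set

⟦_⟧ : Bool → ℕ
⟦ true  ⟧ = 1
⟦ false ⟧ = 0

∑-syntax : List A → (A → ℕ) → ℕ
∑-syntax xs f = foldr (λ x s → f x + s) 0 xs

infixl 10 ∑-syntax
syntax ∑-syntax xs (λ x → e) = ∑[ x ∈ xs ] e

∑-cong : (xs : List A) {f g : A → ℕ} → (∀ x → f x ≡ g x) → ∑[ x ∈ xs ] f x ≡ ∑[ x ∈ xs ] g x
∑-cong []       f≗g = refl
∑-cong (x ∷ xs) f≗g = cong₂ _+_ (f≗g x) (∑-cong xs f≗g)

∑-mono-≤ : (xs : List A) {f g : A → ℕ} → (∀ x → f x ≤ g x) → ∑[ x ∈ xs ] f x ≤ ∑[ x ∈ xs ] g x
∑-mono-≤ []       f≤g = z≤n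
∑-mono-≤ (x ∷ xs) f≤g = +-mono-≤ (f≤g x) (∑-mono-≤ xs f≤g)

∑-distrib-+ : (xs : List A) (f g : A → ℕ) →
              ∑[ x ∈ xs ] (f x + g x) ≡ ∑[ x ∈ xs ] f x + ∑[ x ∈ xs ] g x
∑-distrib-+ []       f g = refl
∑-distrib-+ (x ∷ xs) f g =
  trans (cong (f x + g x +_) (∑-distrib-+ xs f g)) (interchange (f x) (g x) _ _)

*-distribˡ-∑ : (c : ℕ) (xs : List A) (f : A → ℕ) → c * ∑[ x ∈ xs ] f x ≡ ∑[ x ∈ xs ] (c * f x)
*-distribˡ-∑ c []       f = *-zeroʳ c
*-distribˡ-∑ c (x ∷ xs) f = trans (*-distribˡ-+ c (f x) _) (cong (c * f x +_) (*-distribˡ-∑ c xs f))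

∑-const : (xs : List A) (c : ℕ) → ∑[ x ∈ xs ] c ≡ length xs * c
∑-const []       c = refl
∑-const (x ∷ xs) c = cong (c +_) (∑-const xs c)

∑-vanishing : (xs : List A) {f : A → ℕ} → (∀ x → f x ≡ 0) → ∑[ x ∈ xs ] f x ≡ 0
∑-vanishing xs f≗0 = trans (∑-cong xs f≗0) (trans (∑-const xs 0) (*-zeroʳ (length xs)))

∑-++ : (xs ys : List A) (f : A → ℕ) → ∑[ x ∈ xs ++ ys ] f x ≡ ∑[ x ∈ xs ] f x + ∑[ x ∈ ys ] f x
∑-++ []       ys f = refl
∑-++ (x ∷ xs) ys f = trans (cong (f x +_) (∑-++ xs ys f)) (sym (+-assoc (f x) _ _))

∑-map : (g : B → A) (ys : List B) (f : A → ℕ) → ∑[ x ∈ map g ys ] f x ≡ ∑[ y ∈ ys ] f (g y)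
∑-map g []       f = refl
∑-map g (y ∷ ys) f = cong (f (g y) +_) (∑-map g ys f)

∑-comm : (xs : List A) (ys : List B) (f : A → B → ℕ) →
         ∑[ x ∈ xs ] ∑[ y ∈ ys ] f x y ≡ ∑[ y ∈ ys ] ∑[ x ∈ xs ] f x y
∑-comm []       ys f = sym (∑-vanishing ys (λ _ → refl))
∑-comm (x ∷ xs) ys f =
  trans (cong (∑[ y ∈ ys ] f x y +_) (∑-comm xs ys f)) (sym (∑-distrib-+ ys (f x) _))

∑-cartesianProduct : (xs : List A) (ys : List B) (f : A × B → ℕ) →
                     ∑[ p ∈ cartesianProduct xs ys ] f p ≡ ∑[ x ∈ xs ] ∑[ y ∈ ys ] f (x , y)
∑-cartesianProduct []       ys f = refl
∑-cartesianProduct (x ∷ xs) ys f =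
  trans (∑-++ (map (x ,_) ys) _ f) (cong₂ _+_ (∑-map (x ,_) ys f) (∑-cartesianProduct xs ys f))

∑-upTo-suc : (M : ℕ) (f : ℕ → ℕ) → ∑[ a ∈ upTo (suc M) ] f a ≡ f 0 + ∑[ a ∈ upTo M ] f (suc a)
∑-upTo-suc M f =
  cong (f 0 +_) (trans (cong (λ as → ∑[ a ∈ as ] f a) (sym (map-upTo suc M))) (∑-map suc (upTo M) f))

∑-upTo-last : (M : ℕ) (f : ℕ → ℕ) → ∑[ a ∈ upTo (suc M) ] f a ≡ ∑[ a ∈ upTo M ] f a + f M
∑-upTo-last M f = begin
  ∑[ a ∈ upTo (suc M) ] f a        ≡⟨ cong (λ as → ∑[ a ∈ as ] f a) (sym (upTo-∷ʳ M)) ⟩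
  ∑[ a ∈ upTo M ∷ʳ M ] f a         ≡⟨ ∑-++ (upTo M) (M ∷ []) f ⟩
  ∑[ a ∈ upTo M ] f a + (f M + 0)  ≡⟨ cong (∑[ a ∈ upTo M ] f a +_) (+-identityʳ (f M)) ⟩
  ∑[ a ∈ upTo M ] f a + f M        ∎
  where open ≡-Reasoning

∑-upTo-shift : (M : ℕ) (f : ℕ → ℕ) → f 0 ≡ 0 → f M ≡ 0 →
               ∑[ a ∈ upTo M ] f a ≡ ∑[ a ∈ upTo M ] f (suc a)
∑-upTo-shift M f f0≡0 fM≡0 = begin
  ∑[ a ∈ upTo M ] f a              ≡⟨ sym (+-identityʳ _) ⟩
  ∑[ a ∈ upTo M ] f a + 0          ≡⟨ cong (∑[ a ∈ upTo M ] f a +_) (sym fM≡0) ⟩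
  ∑[ a ∈ upTo M ] f a + f M        ≡⟨ sym (∑-upTo-last M f) ⟩
  ∑[ a ∈ upTo (suc M) ] f a        ≡⟨ ∑-upTo-suc M f ⟩
  f 0 + ∑[ a ∈ upTo M ] f (suc a)  ≡⟨ cong (_+ ∑[ a ∈ upTo M ] f (suc a)) f0≡0 ⟩
  ∑[ a ∈ upTo M ] f (suc a)        ∎
  where open ≡-Reasoning

∑-allFin-suc : (m : ℕ) (f : Fin (suc m) → ℕ) →
               ∑[ i ∈ allFin (suc m) ] f i ≡ f fzero + ∑[ i ∈ allFin m ] f (fsuc i)
∑-allFin-suc m f = cong (f fzero +_)
  (trans (cong (λ is → ∑[ i ∈ is ] f i) (sym (map-tabulate (λ i → i) fsuc))) (∑-map fsuc (allFin m) f))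

∑-allFin-toℕ : (m : ℕ) (f : ℕ → ℕ) → ∑[ i ∈ allFin m ] f (toℕ i) ≡ ∑[ a ∈ upTo m ] f a
∑-allFin-toℕ zero    f = refl
∑-allFin-toℕ (suc m) f = trans (∑-allFin-suc m (f ∘ toℕ))
  (trans (cong (f 0 +_) (∑-allFin-toℕ m (f ∘ suc))) (sym (∑-upTo-suc m f)))

∑-allFin≤∑-upTo : ∀ m (f : ℕ → ℕ) → ∑[ i ∈ allFin m ] f (suc (toℕ i)) ≤ ∑[ a ∈ upTo (2 + m) ] f a
∑-allFin≤∑-upTo m f = begin
  ∑[ i ∈ allFin m ] f (suc (toℕ i))      ≡⟨ ∑-allFin-toℕ m (f ∘ suc) ⟩
  ∑[ a ∈ upTo m ] f (suc a)              ≤⟨ m≤m+n _ (f (suc m)) ⟩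
  ∑[ a ∈ upTo m ] f (suc a) + f (suc m)  ≡⟨ sym (∑-upTo-last m (f ∘ suc)) ⟩
  ∑[ a ∈ upTo (suc m) ] f (suc a)        ≤⟨ m≤n+m _ (f 0) ⟩
  f 0 + ∑[ a ∈ upTo (suc m) ] f (suc a)  ≡⟨ sym (∑-upTo-suc (suc m) f) ⟩
  ∑[ a ∈ upTo (2 + m) ] f a              ∎
  where open ≤-Reasoning

∑window : ∀ {m n} → (Fin m × Fin n → ℕ) → ℕ
∑window {m} {n} f = ∑[ i ∈ allFin m ] ∑[ j ∈ allFin n ] f (i , j)

∑window-distrib-+ : ∀ {m n} (f g : Fin m × Fin n → ℕ) →
                    ∑window (λ w → f w + g w) ≡ ∑window f + ∑window g
∑window-distrib-+ {m} {n} f g =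
  trans (∑-cong (allFin m) (λ i → ∑-distrib-+ (allFin n) _ _)) (∑-distrib-+ (allFin m) _ _)

length-filter≡∑ : (P : A → Bool) (xs : List A) →
                  length (filter (λ x → P x Bool.≟ true) xs) ≡ ∑[ x ∈ xs ] ⟦ P x ⟧
length-filter≡∑ P []       = refl
length-filter≡∑ P (x ∷ xs) with P x
... | true  = cong suc (length-filter≡∑ P xs)
... | false = length-filter≡∑ P xs

count-∑ : ∀ {m n} (P : Vertex m n → Bool) → count P ≡ ∑[ k ∈ kinds ] ∑window (λ w → ⟦ P (k , w) ⟧)
count-∑ {m} {n} P = begin
  count P
    ≡⟨ length-filter≡∑ P (vertices m n) ⟩
  ∑[ v ∈ vertices m n ] ⟦ P v ⟧
    ≡⟨ ∑-cartesianProduct kinds window (λ v → ⟦ P v ⟧) ⟩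
  ∑[ k ∈ kinds ] ∑[ w ∈ window ] ⟦ P (k , w) ⟧
    ≡⟨ ∑-cong kinds (λ k → ∑-cartesianProduct (allFin m) (allFin n) (λ w → ⟦ P (k , w) ⟧)) ⟩
  ∑[ k ∈ kinds ] ∑window (λ w → ⟦ P (k , w) ⟧) ∎
  where
  open ≡-Reasoning
  window = cartesianProduct (allFin m) (allFin n)

length-vertices : ∀ m n → length (vertices m n) ≡ 6 * (m * n)
length-vertices m n = begin
  length (vertices m n)
    ≡⟨ length-∑ (vertices m n) ⟩
  ∑[ v ∈ vertices m n ] 1
    ≡⟨ ∑-cartesianProduct kinds window (λ _ → 1) ⟩
  ∑[ k ∈ kinds ] ∑[ w ∈ window ] 1
    ≡⟨ ∑-cong kinds (λ k → ∑-cartesianProduct (allFin m) (allFin n) (λ _ → 1)) ⟩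
  ∑[ k ∈ kinds ] ∑[ i ∈ allFin m ] ∑[ j ∈ allFin n ] 1
    ≡⟨ ∑-cong kinds (λ k → ∑-cong (allFin m) (λ i → ∑-allFin-const n 1)) ⟩
  ∑[ k ∈ kinds ] ∑[ i ∈ allFin m ] (n * 1)
    ≡⟨ ∑-cong kinds (λ k → ∑-allFin-const m (n * 1)) ⟩
  ∑[ k ∈ kinds ] (m * (n * 1))
    ≡⟨ cong (λ x → 6 * (m * x)) (*-identityʳ n) ⟩
  6 * (m * n) ∎
  where
  open ≡-Reasoning
  window = cartesianProduct (allFin m) (allFin n)
  length-∑ : (xs : List A) → length xs ≡ ∑[ x ∈ xs ] 1
  length-∑ []       = refl
  length-∑ (x ∷ xs) = cong suc (length-∑ xs)
  ∑-allFin-const : ∀ m c → ∑[ i ∈ allFin m ] c ≡ m * c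
  ∑-allFin-const m c = trans (∑-const (allFin m) c) (cong (_* c) (length-tabulate (λ (i : Fin m) → i)))

Pos : Set
Pos = ℕ × ℕ

-- The tiles of cluster w sit at pos w, shifted by one so that every neighbour of a tile of the
-- window has a position in ℕ²; extend puts false at all other positions, the axes included.
pos : ∀ {m n} → Fin m × Fin n → Pos
pos (i , j) = suc (toℕ i) , suc (toℕ j)

extend : ∀ {m} → (Fin m → Bool) → ℕ → Bool
extend         F zero          = false
extend {zero}  F (suc a)       = false
extend {suc m} F (suc zero)    = F fzero
extend {suc m} F (suc (suc a)) = extend (F ∘ fsuc) (suc a)

extend-toℕ : ∀ {m} (F : Fin m → Bool) i → extend F (suc (toℕ i)) ≡ F i
extend-toℕ F fzero    = refl
extend-toℕ F (fsuc i) = extend-toℕ (F ∘ fsuc) i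

extend-true : ∀ {m} (F : Fin m → Bool) a → extend F a ≡ true →
              Σ (Fin m) λ i → a ≡ suc (toℕ i) × F i ≡ true
extend-true {suc m} F (suc zero)    Fa = fzero , refl , Fa
extend-true {suc m} F (suc (suc a)) Fa with extend-true (F ∘ fsuc) (suc a) Fa
... | i , refl , Fi = fsuc i , refl , Fi

extend-∧ : ∀ {m} (F : Fin m → Bool) x a → extend (λ i → F i ∧ x) a ≡ (extend F a ∧ x)
extend-∧         F x zero          = refl
extend-∧ {zero}  F x (suc a)       = refl
extend-∧ {suc m} F x (suc zero)    = refl
extend-∧ {suc m} F x (suc (suc a)) = extend-∧ (F ∘ fsuc) x (suc a)

extend² : ∀ {m n} → (Fin m × Fin n → Bool) → Pos → Bool
extend² G (a , b) = extend (λ i → extend (λ j → G (i , j)) b) a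

extend²-pos : ∀ {m n} (G : Fin m × Fin n → Bool) w → extend² G (pos w) ≡ G w
extend²-pos G (i , j) = trans (extend-toℕ _ i) (extend-toℕ _ j)

extend²-true : ∀ {m n} (G : Fin m × Fin n → Bool) q → extend² G q ≡ true →
               Σ (Fin m × Fin n) λ w → q ≡ pos w × G w ≡ true
extend²-true G (a , b) Gq with extend-true _ a Gq
... | i , refl , Gi with extend-true _ b Gi
...   | j , refl , Gw = (i , j) , refl , Gw

data Offset : Set where
  here +v₁ -v₁ +v₂ -v₂ : Offset

_⊕_ : Pos → Offset → Pos
(a , b) ⊕ here = a , b
(a , b) ⊕ +v₁  = suc a , b
(a , b) ⊕ -v₁  = a ∸ 1 , b
(a , b) ⊕ +v₂  = a , suc b
(a , b) ⊕ -v₂  = a , b ∸ 1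

opposite : Offset → Offset
opposite here = here
opposite +v₁  = -v₁
opposite -v₁  = +v₁
opposite +v₂  = -v₂
opposite -v₂  = +v₂

≡ᵇ-sym : ∀ x y → (x ≡ᵇ y) ≡ (y ≡ᵇ x)
≡ᵇ-sym zero    zero    = refl
≡ᵇ-sym zero    (suc y) = refl
≡ᵇ-sym (suc x) zero    = refl
≡ᵇ-sym (suc x) (suc y) = ≡ᵇ-sym x y

-- The two orientations in which the definition of adjacency compares coordinates.
_isAt_ : ∀ {m n} → Fin m × Fin n → Pos → Bool
(i , j) isAt (a , b) = (suc (toℕ i) ≡ᵇ a) ∧ (suc (toℕ j) ≡ᵇ b)

_∋_ : ∀ {m n} → Pos → Fin m × Fin n → Bool
(a , b) ∋ (i , j) = (a ≡ᵇ suc (toℕ i)) ∧ (b ≡ᵇ suc (toℕ j))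

∋≡isAt : ∀ {m n} q (w : Fin m × Fin n) → q ∋ w ≡ w isAt q
∋≡isAt (a , b) (i , j) = cong₂ _∧_ (≡ᵇ-sym a _) (≡ᵇ-sym b _)

isAt⇒≡ : ∀ {m n} (w : Fin m × Fin n) q → w isAt q ≡ true → pos w ≡ q
isAt⇒≡ (i , j) (a , b) _ with suc (toℕ i) ≡ᵇ a in i≡a | suc (toℕ j) ≡ᵇ b in j≡b
... | true | true = cong₂ _,_ (≡ᵇ-true i≡a) (≡ᵇ-true j≡b)
  where
  ≡ᵇ-true : ∀ {x y} → (x ≡ᵇ y) ≡ true → x ≡ y
  ≡ᵇ-true {x} {y} e = ≡ᵇ⇒≡ x y (subst T (sym e) _)

∑-pick : ∀ {m} (F : Fin m → Bool) a → ∑[ i ∈ allFin m ] ⟦ F i ∧ (suc (toℕ i) ≡ᵇ a) ⟧ ≡ ⟦ extend F a ⟧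
∑-pick {zero}  F zero    = refl
∑-pick {zero}  F (suc a) = refl
∑-pick {suc m} F a = trans (∑-allFin-suc m (λ i → ⟦ F i ∧ (suc (toℕ i) ≡ᵇ a) ⟧)) (by-cases a)
  where
  unpicked : ⟦ F fzero ∧ false ⟧ ≡ 0
  unpicked = cong ⟦_⟧ (∧-zeroʳ (F fzero))
  by-cases : ∀ a → ⟦ F fzero ∧ (1 ≡ᵇ a) ⟧ + ∑[ i ∈ allFin m ] ⟦ F (fsuc i) ∧ (2 + toℕ i ≡ᵇ a) ⟧
                   ≡ ⟦ extend F a ⟧
  by-cases zero          = cong₂ _+_ unpicked (∑-pick (F ∘ fsuc) zero)
  by-cases (suc zero)    =
    trans (cong₂ _+_ (cong ⟦_⟧ (∧-identityʳ (F fzero))) (∑-pick (F ∘ fsuc) zero)) (+-identityʳ _)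
  by-cases (suc (suc a)) = cong₂ _+_ unpicked (∑-pick (F ∘ fsuc) (suc a))

module _ {m n} (G : Fin m × Fin n → Bool) where

  ∑-isAt : ∀ q → ∑window (λ w → ⟦ G w ∧ (w isAt q) ⟧) ≡ ⟦ extend² G q ⟧
  ∑-isAt (a , b) = begin
    ∑[ i ∈ allFin m ] ∑[ j ∈ allFin n ] ⟦ G (i , j) ∧ ((suc (toℕ i) ≡ᵇ a) ∧ (suc (toℕ j) ≡ᵇ b)) ⟧
      ≡⟨ ∑-cong (allFin m) (λ i → ∑-cong (allFin n) (λ j → cong ⟦_⟧ (sym (∧-assoc (G (i , j)) _ _)))) ⟩
    ∑[ i ∈ allFin m ] ∑[ j ∈ allFin n ] ⟦ (G (i , j) ∧ (suc (toℕ i) ≡ᵇ a)) ∧ (suc (toℕ j) ≡ᵇ b) ⟧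
      ≡⟨ ∑-cong (allFin m) (λ i → ∑-pick (λ j → G (i , j) ∧ (suc (toℕ i) ≡ᵇ a)) b) ⟩
    ∑[ i ∈ allFin m ] ⟦ extend (λ j → G (i , j) ∧ (suc (toℕ i) ≡ᵇ a)) b ⟧
      ≡⟨ ∑-cong (allFin m) (λ i → cong ⟦_⟧ (extend-∧ (λ j → G (i , j)) _ b)) ⟩
    ∑[ i ∈ allFin m ] ⟦ extend (λ j → G (i , j)) b ∧ (suc (toℕ i) ≡ᵇ a) ⟧
      ≡⟨ ∑-pick (λ i → extend (λ j → G (i , j)) b) a ⟩
    ⟦ extend² G (a , b) ⟧ ∎
    where open ≡-Reasoning

  ∑-none : ∑window (λ w → ⟦ G w ∧ false ⟧) ≡ 0
  ∑-none = ∑-vanishing (allFin m) (λ i → ∑-vanishing (allFin n) (λ j → cong ⟦_⟧ (∧-zeroʳ (G (i , j)))))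

  ∑-one : ∀ {C : Fin m × Fin n → Bool} (v : Fin m × Fin n) o → (∀ w → C w ≡ w isAt (pos v ⊕ o)) →
          ∑window (λ w → ⟦ G w ∧ C w ⟧) ≡ ∑[ o′ ∈ o ∷ [] ] ⟦ extend² G (pos v ⊕ o′) ⟧
  ∑-one v o C≡ =
    trans (∑-cong (allFin m) (λ i → ∑-cong (allFin n) (λ j → cong (λ c → ⟦ G (i , j) ∧ c ⟧) (C≡ (i , j)))))
          (trans (∑-isAt (pos v ⊕ o)) (sym (+-identityʳ _)))

  ∑-two : ∀ {C : Fin m × Fin n → Bool} (v : Fin m × Fin n) o o′ → let q = pos v ⊕ o; q′ = pos v ⊕ o′ in
          q ≢ q′ → (∀ w → C w ≡ (w isAt q ∨ w isAt q′)) →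
          ∑window (λ w → ⟦ G w ∧ C w ⟧) ≡ ∑[ o″ ∈ o ∷ o′ ∷ [] ] ⟦ extend² G (pos v ⊕ o″) ⟧
  ∑-two {C} v o o′ q≢q′ C≡ = begin
    ∑window (λ w → ⟦ G w ∧ C w ⟧)
      ≡⟨ ∑-cong (allFin m) (λ i → ∑-cong (allFin n) (λ j → split (i , j))) ⟩
    ∑window (λ w → ⟦ G w ∧ (w isAt q) ⟧ + ⟦ G w ∧ (w isAt q′) ⟧)
      ≡⟨ ∑window-distrib-+ (λ w → ⟦ G w ∧ (w isAt q) ⟧) (λ w → ⟦ G w ∧ (w isAt q′) ⟧) ⟩
    ∑window (λ w → ⟦ G w ∧ (w isAt q) ⟧) + ∑window (λ w → ⟦ G w ∧ (w isAt q′) ⟧)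
      ≡⟨ cong₂ _+_ (∑-isAt q) (trans (∑-isAt q′) (sym (+-identityʳ _))) ⟩
    ⟦ extend² G q ⟧ + (⟦ extend² G q′ ⟧ + 0) ∎
    where
    open ≡-Reasoning
    q = pos v ⊕ o
    q′ = pos v ⊕ o′
    disjoint : ∀ w → (w isAt q ∧ w isAt q′) ≡ false
    disjoint w with w isAt q in at-q | w isAt q′ in at-q′
    ... | false | _     = refl
    ... | true  | false = refl
    ... | true  | true  = ⊥-elim (q≢q′ (trans (sym (isAt⇒≡ w q at-q)) (isAt⇒≡ w q′ at-q′)))
    ⟦∧∨⟧ : ∀ x a b → (a ∧ b) ≡ false → ⟦ x ∧ (a ∨ b) ⟧ ≡ ⟦ x ∧ a ⟧ + ⟦ x ∧ b ⟧
    ⟦∧∨⟧ false a     b     _ = refl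
    ⟦∧∨⟧ true  true  false _ = refl
    ⟦∧∨⟧ true  false b     _ = refl
    split : ∀ w → ⟦ G w ∧ C w ⟧ ≡ ⟦ G w ∧ (w isAt q) ⟧ + ⟦ G w ∧ (w isAt q′) ⟧
    split w = trans (cong (λ c → ⟦ G w ∧ c ⟧) (C≡ w)) (⟦∧∨⟧ (G w) _ _ (disjoint w))

  ∑-one′ : ∀ {C : Fin m × Fin n → Bool} (v : Fin m × Fin n) o → (∀ w → C w ≡ (pos v ⊕ o) ∋ w) →
           ∑window (λ w → ⟦ G w ∧ C w ⟧) ≡ ∑[ o′ ∈ o ∷ [] ] ⟦ extend² G (pos v ⊕ o′) ⟧
  ∑-one′ v o C≡ = ∑-one v o (λ w → trans (C≡ w) (∋≡isAt (pos v ⊕ o) w))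

  ∑-two′ : ∀ {C : Fin m × Fin n → Bool} (v : Fin m × Fin n) o o′ → let q = pos v ⊕ o; q′ = pos v ⊕ o′ in
           q ≢ q′ → (∀ w → C w ≡ (q ∋ w ∨ q′ ∋ w)) →
           ∑window (λ w → ⟦ G w ∧ C w ⟧) ≡ ∑[ o″ ∈ o ∷ o′ ∷ [] ] ⟦ extend² G (pos v ⊕ o″) ⟧
  ∑-two′ v o o′ q≢q′ C≡ = ∑-two v o o′ q≢q′
    (λ w → trans (C≡ w) (cong₂ _∨_ (∋≡isAt (pos v ⊕ o) w) (∋≡isAt (pos v ⊕ o′) w)))

nbhd : Kind → Kind → List Offset
nbhd hex  sq₁  = here ∷ -v₁ ∷ []
nbhd hex  sq₂  = here ∷ -v₂ ∷ []
nbhd hex  sq₃  = -v₁ ∷ -v₂ ∷ []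
nbhd sq₁  hex  = here ∷ +v₁ ∷ []
nbhd sq₁  up   = here ∷ []
nbhd sq₁  down = -v₂ ∷ []
nbhd sq₂  hex  = here ∷ +v₂ ∷ []
nbhd sq₂  up   = here ∷ []
nbhd sq₂  down = -v₁ ∷ []
nbhd sq₃  hex  = +v₁ ∷ +v₂ ∷ []
nbhd sq₃  up   = here ∷ []
nbhd sq₃  down = here ∷ []
nbhd up   sq₁  = here ∷ []
nbhd up   sq₂  = here ∷ []
nbhd up   sq₃  = here ∷ []
nbhd down sq₁  = +v₂ ∷ []
nbhd down sq₂  = +v₁ ∷ []
nbhd down sq₃  = here ∷ []
nbhd _    _    = []

everyKind : {P : Kind → Set} → P hex → P sq₁ → P sq₂ → P sq₃ → P up → P down → ∀ k → P k
everyKind p _ _ _ _ _ hex  = p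
everyKind _ p _ _ _ _ sq₁  = p
everyKind _ _ p _ _ _ sq₂  = p
everyKind _ _ _ p _ _ sq₃  = p
everyKind _ _ _ _ p _ up   = p
everyKind _ _ _ _ _ p down = p

nbhd-sym : ∀ k k′ → map opposite (nbhd k k′) ≡ nbhd k′ k
nbhd-sym hex  = everyKind refl refl refl refl refl refl
nbhd-sym sq₁  = everyKind refl refl refl refl refl refl
nbhd-sym sq₂  = everyKind refl refl refl refl refl refl
nbhd-sym sq₃  = everyKind refl refl refl refl refl refl
nbhd-sym up   = everyKind refl refl refl refl refl refl
nbhd-sym down = everyKind refl refl refl refl refl refl

apart₁ : ∀ {a a′ b b′ : ℕ} → a ≢ a′ → (a , b) ≢ (a′ , b′)
apart₁ a≢a′ e = a≢a′ (cong proj₁ e)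

apart₂ : ∀ {a a′ b b′ : ℕ} → b ≢ b′ → (a , b) ≢ (a′ , b′)
apart₂ b≢b′ e = b≢b′ (cong proj₂ e)

∑-adj : ∀ {m n} (k k′ : Kind) (G : Fin m × Fin n → Bool) (v : Fin m × Fin n) →
        ∑window (λ w → ⟦ G w ∧ adj (k′ , w) (k , v) ⟧) ≡ ∑[ o ∈ nbhd k k′ ] ⟦ extend² G (pos v ⊕ o) ⟧
∑-adj hex  hex  G v = ∑-none G
∑-adj hex  sq₁  G v = ∑-two′ G v here -v₁ (apart₁ 1+n≢n) (λ _ → refl)
∑-adj hex  sq₂  G v = ∑-two′ G v here -v₂ (apart₂ 1+n≢n) (λ _ → refl)
∑-adj hex  sq₃  G v = ∑-two′ G v -v₁ -v₂ (apart₁ (≢-sym 1+n≢n)) (λ _ → refl)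
∑-adj hex  up   G v = ∑-none G
∑-adj hex  down G v = ∑-none G
∑-adj sq₁  hex  G v = ∑-two G v here +v₁ (apart₁ (≢-sym 1+n≢n)) (λ _ → ∨-identityʳ _)
∑-adj sq₁  sq₁  G v = ∑-none G
∑-adj sq₁  sq₂  G v = ∑-none G
∑-adj sq₁  sq₃  G v = ∑-none G
∑-adj sq₁  up   G v = ∑-one G v here (λ _ → ∨-identityʳ _)
∑-adj sq₁  down G v = ∑-one′ G v -v₂ (λ _ → ∨-identityʳ _)
∑-adj sq₂  hex  G v = ∑-two G v here +v₂ (apart₂ (≢-sym 1+n≢n)) (λ _ → ∨-identityʳ _)
∑-adj sq₂  sq₁  G v = ∑-none G
∑-adj sq₂  sq₂  G v = ∑-none G
∑-adj sq₂  sq₃  G v = ∑-none G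
∑-adj sq₂  up   G v = ∑-one G v here (λ _ → ∨-identityʳ _)
∑-adj sq₂  down G v = ∑-one′ G v -v₁ (λ _ → ∨-identityʳ _)
∑-adj sq₃  hex  G v = ∑-two G v +v₁ +v₂ (apart₁ 1+n≢n) (λ _ → ∨-identityʳ _)
∑-adj sq₃  sq₁  G v = ∑-none G
∑-adj sq₃  sq₂  G v = ∑-none G
∑-adj sq₃  sq₃  G v = ∑-none G
∑-adj sq₃  up   G v = ∑-one G v here (λ _ → ∨-identityʳ _)
∑-adj sq₃  down G v = ∑-one G v here (λ _ → ∨-identityʳ _)
∑-adj up   hex  G v = ∑-none G
∑-adj up   sq₁  G v = ∑-one′ G v here (λ _ → refl)
∑-adj up   sq₂  G v = ∑-one′ G v here (λ _ → refl)
∑-adj up   sq₃  G v = ∑-one′ G v here (λ _ → refl)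
∑-adj up   up   G v = ∑-none G
∑-adj up   down G v = ∑-none G
∑-adj down hex  G v = ∑-none G
∑-adj down sq₁  G v = ∑-one G v +v₂ (λ _ → refl)
∑-adj down sq₂  G v = ∑-one G v +v₁ (λ _ → refl)
∑-adj down sq₃  G v = ∑-one′ G v here (λ _ → refl)
∑-adj down up   G v = ∑-none G
∑-adj down down G v = ∑-none G

∑nbr : Kind → (Kind → Offset → ℕ) → ℕ
∑nbr k f = ∑[ k′ ∈ kinds ] ∑[ o ∈ nbhd k k′ ] f k′ o

∑nbr-cong : ∀ k {f g : Kind → Offset → ℕ} → (∀ k′ o → f k′ o ≡ g k′ o) → ∑nbr k f ≡ ∑nbr k g
∑nbr-cong k {f} {g} f≗g =
  ∑-cong kinds {λ k′ → ∑[ o ∈ nbhd k k′ ] f k′ o} {λ k′ → ∑[ o ∈ nbhd k k′ ] g k′ o}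
    (λ k′ → ∑-cong (nbhd k k′) (f≗g k′))

∑nbr-mono-≤ : ∀ k {f g : Kind → Offset → ℕ} → (∀ k′ o → f k′ o ≤ g k′ o) → ∑nbr k f ≤ ∑nbr k g
∑nbr-mono-≤ k {f} {g} f≤g =
  ∑-mono-≤ kinds {λ k′ → ∑[ o ∈ nbhd k k′ ] f k′ o} {λ k′ → ∑[ o ∈ nbhd k k′ ] g k′ o}
    (λ k′ → ∑-mono-≤ (nbhd k k′) (f≤g k′))

∑nbr-distrib-+ : ∀ k (f g : Kind → Offset → ℕ) → ∑nbr k (λ k′ o → f k′ o + g k′ o) ≡ ∑nbr k f + ∑nbr k g
∑nbr-distrib-+ k f g = trans (∑-cong kinds (λ k′ → ∑-distrib-+ (nbhd k k′) (f k′) (g k′)))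
  (∑-distrib-+ kinds (λ k′ → ∑[ o ∈ nbhd k k′ ] f k′ o) (λ k′ → ∑[ o ∈ nbhd k k′ ] g k′ o))

*-distribˡ-∑nbr : ∀ c k (f : Kind → Offset → ℕ) → c * ∑nbr k f ≡ ∑nbr k (λ k′ o → c * f k′ o)
*-distribˡ-∑nbr c k f = trans (*-distribˡ-∑ c kinds (λ k′ → ∑[ o ∈ nbhd k k′ ] f k′ o))
  (∑-cong kinds (λ k′ → *-distribˡ-∑ c (nbhd k k′) (f k′)))

degree : Kind → ℕ
degree k = ∑nbr k (λ _ _ → 1)

configuration : ∀ {m n} → (Vertex m n → Bool) → Kind → Pos → Bool
configuration S k = extend² (λ w → S (k , w))

nbrsIn-∑nbr : ∀ {m n} (S : Vertex m n → Bool) k v →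
              nbrsIn S (k , v) ≡ ∑nbr k (λ k′ o → ⟦ configuration S k′ (pos v ⊕ o) ⟧)
nbrsIn-∑nbr S k v = trans (count-∑ (λ u → S u ∧ adj u (k , v)))
  (∑-cong kinds (λ k′ → ∑-adj k k′ (λ w → S (k′ , w)) v))

deg≤degree : ∀ {m n} k (v : Fin m × Fin n) → deg (k , v) ≤ degree k
deg≤degree {m} {n} k v = ≤-trans (≤-reflexive (nbrsIn-∑nbr everything k v))
  (∑nbr-mono-≤ k (λ k′ o → ⟦⟧≤1 (configuration everything k′ (pos v ⊕ o))))
  where
  everything : Vertex m n → Bool
  everything _ = true
  ⟦⟧≤1 : ∀ b → ⟦ b ⟧ ≤ 1
  ⟦⟧≤1 true  = ≤-refl
  ⟦⟧≤1 false = z≤n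

weight : Kind → ℕ
weight hex  = 2
weight up   = 9
weight down = 9
weight _    = 4

charge : Kind → Kind → Bool → Bool → ℕ
charge k k′ false _     = 0
charge k k′ true  true  = weight k′
charge k k′ true  false = weight k + weight k′

charge-pair : ∀ k k′ x y → charge k k′ x y + charge k′ k y x ≤ weight k + weight k′
charge-pair k k′ true  true  = ≤-reflexive (+-comm (weight k′) (weight k))
charge-pair k k′ true  false = ≤-reflexive (+-identityʳ _)
charge-pair k k′ false true  = ≤-reflexive (+-comm (weight k′) (weight k))
charge-pair k k′ false false = z≤n

charge-selected : ∀ k k′ y → charge k k′ true y + weight k * ⟦ y ⟧ ≡ weight k + weight k′
charge-selected k k′ true  = trans (cong (weight k′ +_) (*-identityʳ (weight k))) (+-comm (weight k′) (weight k))
charge-selected k k′ false = trans (cong (weight k + weight k′ +_) (*-zeroʳ (weight k))) (+-identityʳ _)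

capacity : Kind → ℕ
capacity k = ∑nbr k (λ k′ _ → weight k + weight k′)

capacity-tight : ∀ k → capacity k ≡ 30 + weight k * (degree k / 2)
capacity-tight = everyKind refl refl refl refl refl refl

sent : (Kind → Pos → Bool) → Kind → Pos → ℕ
sent X k p = ∑nbr k (λ k′ o → charge k k′ (X k p) (X k′ (p ⊕ o)))

sent-≥30 : ∀ X k p → X k p ≡ true → ∑nbr k (λ k′ o → ⟦ X k′ (p ⊕ o) ⟧) ≤ degree k / 2 → 30 ≤ sent X k p
sent-≥30 X k p selected few = +-cancelʳ-≤ (weight k * (degree k / 2)) 30 (sent X k p) (begin
  30 + weight k * (degree k / 2)  ≡⟨ sym (capacity-tight k) ⟩
  capacity k                      ≡⟨ sym (∑nbr-cong k (λ k′ o → charge-selected k k′ (X k′ (p ⊕ o)))) ⟩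
  ∑nbr k (λ k′ o → charge k k′ true (X k′ (p ⊕ o)) + weight k * ⟦ X k′ (p ⊕ o) ⟧)
    ≡⟨ ∑nbr-distrib-+ k (λ k′ o → charge k k′ true (X k′ (p ⊕ o))) (λ k′ o → weight k * ⟦ X k′ (p ⊕ o) ⟧) ⟩
  ∑nbr k (λ k′ o → charge k k′ true (X k′ (p ⊕ o))) + ∑nbr k (λ k′ o → weight k * ⟦ X k′ (p ⊕ o) ⟧)
    ≡⟨ cong₂ _+_ (∑nbr-cong k (λ k′ o → cong (λ x → charge k k′ x (X k′ (p ⊕ o))) (sym selected)))
                 (sym (*-distribˡ-∑nbr (weight k) k (λ k′ o → ⟦ X k′ (p ⊕ o) ⟧))) ⟩
  sent X k p + weight k * ∑nbr k (λ k′ o → ⟦ X k′ (p ⊕ o) ⟧)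
    ≤⟨ +-monoʳ-≤ (sent X k p) (*-monoʳ-≤ (weight k) few) ⟩
  sent X k p + weight k * (degree k / 2) ∎)
  where open ≤-Reasoning

30·selected≤sent : ∀ {m n} (S : Vertex m n → Bool) → HalfDependent S →
                   ∀ k p → 30 * ⟦ configuration S k p ⟧ ≤ sent (configuration S) k p
30·selected≤sent S half-dependent k p = scaled-indicator (configuration S k p) (selected-sends-30 p)
  where
  scaled-indicator : ∀ {c y} x → (x ≡ true → c ≤ y) → c * ⟦ x ⟧ ≤ y
  scaled-indicator {c} true  c≤y = ≤-trans (≤-reflexive (*-identityʳ c)) (c≤y refl)
  scaled-indicator {c} false _   = ≤-trans (≤-reflexive (*-zeroʳ c)) z≤n
  selected-sends-30 : ∀ p → configuration S k p ≡ true → 30 ≤ sent (configuration S) k p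
  selected-sends-30 p Sp with extend²-true _ p Sp
  ... | v , refl , selected = sent-≥30 (configuration S) k (pos v) Sp (begin
    ∑nbr k (λ k′ o → ⟦ configuration S k′ (pos v ⊕ o) ⟧)  ≡⟨ sym (nbrsIn-∑nbr S k v) ⟩
    nbrsIn S (k , v)                                      ≤⟨ half-dependent (k , v) selected ⟩
    deg (k , v) / 2                                       ≤⟨ /-monoˡ-≤ 2 (deg≤degree k v) ⟩
    degree k / 2                                          ∎)
    where open ≤-Reasoning

∑box : ℕ → ℕ → (Pos → ℕ) → ℕ
∑box M N f = ∑[ a ∈ upTo M ] ∑[ b ∈ upTo N ] f (a , b)

module _ (M N : ℕ) where

  ∑box-mono-≤ : {f g : Pos → ℕ} → (∀ p → f p ≤ g p) → ∑box M N f ≤ ∑box M N g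
  ∑box-mono-≤ f≤g = ∑-mono-≤ (upTo M) (λ a → ∑-mono-≤ (upTo N) (λ b → f≤g (a , b)))

  ∑box-distrib-+ : (f g : Pos → ℕ) → ∑box M N (λ p → f p + g p) ≡ ∑box M N f + ∑box M N g
  ∑box-distrib-+ f g = trans (∑-cong (upTo M) (λ a → ∑-distrib-+ (upTo N) _ _)) (∑-distrib-+ (upTo M) _ _)

  *-distribˡ-∑box : ∀ c (f : Pos → ℕ) → c * ∑box M N f ≡ ∑box M N (λ p → c * f p)
  *-distribˡ-∑box c f = trans (*-distribˡ-∑ c (upTo M) _) (∑-cong (upTo M) (λ a → *-distribˡ-∑ c (upTo N) _))

  ∑box-const : ∀ c → ∑box M N (λ _ → c) ≡ M * (N * c)
  ∑box-const c = begin
    ∑[ a ∈ upTo M ] ∑[ b ∈ upTo N ] c        ≡⟨ ∑-cong (upTo M) (λ a → ∑-const (upTo N) c) ⟩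
    ∑[ a ∈ upTo M ] (length (upTo N) * c)    ≡⟨ ∑-const (upTo M) _ ⟩
    length (upTo M) * (length (upTo N) * c)  ≡⟨ cong₂ (λ x y → x * (y * c)) (length-upTo M) (length-upTo N) ⟩
    M * (N * c)                              ∎
    where open ≡-Reasoning

  ∑box-∑ : (xs : List A) (f : A → Pos → ℕ) → ∑box M N (λ p → ∑[ x ∈ xs ] f x p) ≡ ∑[ x ∈ xs ] ∑box M N (f x)
  ∑box-∑ xs f = trans (∑-cong (upTo M) (λ a → ∑-comm (upTo N) xs (λ b x → f x (a , b))))
                      (∑-comm (upTo M) xs (λ a x → ∑[ b ∈ upTo N ] f x (a , b)))

  ∑box-∑nbr : (F : Kind → Kind → Offset → Pos → ℕ) →
              ∑box M N (λ p → ∑[ k ∈ kinds ] ∑nbr k (λ k′ o → F k k′ o p))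
              ≡ ∑[ k ∈ kinds ] ∑nbr k (λ k′ o → ∑box M N (F k k′ o))
  ∑box-∑nbr F = trans (∑box-∑ kinds (λ k p → ∑nbr k (λ k′ o → F k k′ o p)))
    (∑-cong kinds (λ k → trans (∑box-∑ kinds (λ k′ p → ∑[ o ∈ nbhd k k′ ] F k k′ o p))
      (∑-cong kinds (λ k′ → ∑box-∑ (nbhd k k′) (F k k′)))))

∑window≤∑box : ∀ {m n} (f : Pos → ℕ) → ∑window {m} {n} (λ w → f (pos w)) ≤ ∑box (2 + m) (2 + n) f
∑window≤∑box {m} {n} f = ≤-trans
  (∑-mono-≤ (allFin m) (λ i → ∑-allFin≤∑-upTo n (λ b → f (suc (toℕ i) , b))))
  (∑-allFin≤∑-upTo m (λ a → ∑[ b ∈ upTo (2 + n) ] f (a , b)))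

OffCentre : ℕ → ℕ → Pos → Set
OffCentre M N (a , b) = (a ≡ 0 ⊎ M ≤ suc a) ⊎ (b ≡ 0 ⊎ N ≤ suc b)

∑box-reindex : ∀ M N (g : Pos → Pos → ℕ) → (∀ q p → OffCentre M N q → g q p ≡ 0) →
               ∀ o → ∑box M N (λ p → g (p ⊕ o) p) ≡ ∑box M N (λ p → g p (p ⊕ opposite o))
∑box-reindex M N g idle here = refl
∑box-reindex M N g idle +v₁  = sym (∑-upTo-shift M (λ a → ∑[ b ∈ upTo N ] g (a , b) (a ∸ 1 , b))
  (∑-vanishing (upTo N) (λ b → idle _ _ (inj₁ (inj₁ refl))))
  (∑-vanishing (upTo N) (λ b → idle _ _ (inj₁ (inj₂ (n≤1+n M))))))
∑box-reindex M N g idle -v₁  = ∑-upTo-shift M (λ a → ∑[ b ∈ upTo N ] g (a ∸ 1 , b) (a , b))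
  (∑-vanishing (upTo N) (λ b → idle _ _ (inj₁ (inj₁ refl))))
  (∑-vanishing (upTo N) (λ b → idle _ _ (inj₁ (inj₂ (m≤n+m∸n M 1)))))
∑box-reindex M N g idle +v₂  = sym (∑-cong (upTo M) (λ a → ∑-upTo-shift N (λ b → g (a , b) (a , b ∸ 1))
  (idle _ _ (inj₂ (inj₁ refl)))
  (idle _ _ (inj₂ (inj₂ (n≤1+n N))))))
∑box-reindex M N g idle -v₂  = ∑-cong (upTo M) (λ a → ∑-upTo-shift N (λ b → g (a , b ∸ 1) (a , b))
  (idle _ _ (inj₂ (inj₁ refl)))
  (idle _ _ (inj₂ (inj₂ (m≤n+m∸n N 1)))))

module Discharging (X : Kind → Pos → Bool) (M N : ℕ) (idle : ∀ k q → OffCentre M N q → X k q ≡ false) where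

  flow : Kind → Kind → Offset → ℕ
  flow k k′ o = ∑box M N (λ p → charge k k′ (X k p) (X k′ (p ⊕ o)))

  total : ℕ
  total = ∑[ k ∈ kinds ] ∑nbr k (flow k)

  backflow : ∀ k k′ o → flow k′ k (opposite o) ≡ ∑box M N (λ p → charge k′ k (X k′ (p ⊕ o)) (X k p))
  backflow k k′ o = sym (∑box-reindex M N (λ q p → charge k′ k (X k′ q) (X k p)) silent o)
    where
    silent : ∀ q p → OffCentre M N q → charge k′ k (X k′ q) (X k p) ≡ 0
    silent q p off rewrite idle k′ q off = refl

  total-reversed : ∑[ k ∈ kinds ] ∑nbr k (λ k′ o → flow k′ k (opposite o)) ≡ total
  total-reversed = begin
    ∑[ k ∈ kinds ] ∑[ k′ ∈ kinds ] ∑[ o ∈ nbhd k k′ ] flow k′ k (opposite o)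
      ≡⟨ ∑-cong kinds (λ k → ∑-cong kinds (λ k′ → sym (∑-map opposite (nbhd k k′) (flow k′ k)))) ⟩
    ∑[ k ∈ kinds ] ∑[ k′ ∈ kinds ] ∑[ o ∈ map opposite (nbhd k k′) ] flow k′ k o
      ≡⟨ ∑-cong kinds (λ k → ∑-cong kinds (λ k′ → cong (λ os → ∑[ o ∈ os ] flow k′ k o) (nbhd-sym k k′))) ⟩
    ∑[ k ∈ kinds ] ∑[ k′ ∈ kinds ] ∑[ o ∈ nbhd k′ k ] flow k′ k o
      ≡⟨ ∑-comm kinds kinds (λ k k′ → ∑[ o ∈ nbhd k′ k ] flow k′ k o) ⟩
    total ∎
    where open ≡-Reasoning

  edge-bound : ∀ k k′ o → flow k k′ o + flow k′ k (opposite o) ≤ ∑box M N (λ _ → weight k + weight k′)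
  edge-bound k k′ o = begin
    flow k k′ o + flow k′ k (opposite o)
      ≡⟨ cong (flow k k′ o +_) (backflow k k′ o) ⟩
    flow k k′ o + ∑box M N (λ p → charge k′ k (X k′ (p ⊕ o)) (X k p))
      ≡⟨ sym (∑box-distrib-+ M N _ _) ⟩
    ∑box M N (λ p → charge k k′ (X k p) (X k′ (p ⊕ o)) + charge k′ k (X k′ (p ⊕ o)) (X k p))
      ≤⟨ ∑box-mono-≤ M N (λ p → charge-pair k k′ (X k p) (X k′ (p ⊕ o))) ⟩
    ∑box M N (λ _ → weight k + weight k′) ∎
    where open ≤-Reasoning

  total-≤ : total ≤ 114 * (M * N)
  total-≤ = *-cancelˡ-≤ 2 (begin
    2 * total
      ≡⟨ cong (total +_) (trans (+-identityʳ total) (sym total-reversed)) ⟩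
    total + ∑[ k ∈ kinds ] ∑nbr k (λ k′ o → flow k′ k (opposite o))
      ≡⟨ sym (∑-distrib-+ kinds (λ k → ∑nbr k (flow k)) (λ k → ∑nbr k (λ k′ o → flow k′ k (opposite o)))) ⟩
    ∑[ k ∈ kinds ] (∑nbr k (flow k) + ∑nbr k (λ k′ o → flow k′ k (opposite o)))
      ≡⟨ ∑-cong kinds (λ k → sym (∑nbr-distrib-+ k (flow k) (λ k′ o → flow k′ k (opposite o)))) ⟩
    ∑[ k ∈ kinds ] ∑nbr k (λ k′ o → flow k k′ o + flow k′ k (opposite o))
      ≤⟨ ∑-mono-≤ kinds (λ k → ∑nbr-mono-≤ k (edge-bound k)) ⟩
    ∑[ k ∈ kinds ] ∑nbr k (λ k′ o → ∑box M N (λ _ → weight k + weight k′))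
      ≡⟨ sym (∑box-∑nbr M N (λ k k′ o _ → weight k + weight k′)) ⟩
    ∑box M N (λ _ → 228)
      ≡⟨ ∑box-const M N 228 ⟩
    M * (N * 228)
      ≡⟨ regroup M N ⟩
    2 * (114 * (M * N)) ∎)
    where
    open ≤-Reasoning
    regroup : ∀ M N → M * (N * 228) ≡ 2 * (114 * (M * N))
    regroup = solve-∀

module _ {m n} (S : Vertex m n → Bool) where

  configuration-off-centre : ∀ k q → OffCentre (2 + m) (2 + n) q → configuration S k q ≡ false
  configuration-off-centre k q off with configuration S k q in Sq
  ... | false = refl
  ... | true with extend²-true _ q Sq
  ...   | (i , j) , refl , _ = ⊥-elim (centred off)
    where
    centred : ¬ OffCentre (2 + m) (2 + n) (pos (i , j))
    centred (inj₁ (inj₂ (s≤s (s≤s m≤i)))) = <⇒≱ (toℕ<n i) m≤i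
    centred (inj₂ (inj₂ (s≤s (s≤s n≤j)))) = <⇒≱ (toℕ<n j) n≤j

  density-bound : HalfDependent S → 30 * count S ≤ 114 * ((2 + m) * (2 + n))
  density-bound half-dependent = begin
    30 * count S
      ≡⟨ cong (30 *_) (count-∑ S) ⟩
    30 * ∑[ k ∈ kinds ] ∑window (λ w → ⟦ S (k , w) ⟧)
      ≡⟨ cong (30 *_) (∑-cong kinds (λ k → ∑-cong (allFin m) (λ i → ∑-cong (allFin n) (λ j →
           cong ⟦_⟧ (sym (extend²-pos (λ w → S (k , w)) (i , j))))))) ⟩
    30 * ∑[ k ∈ kinds ] ∑window {m} {n} (λ w → ⟦ X k (pos w) ⟧)
      ≤⟨ *-monoʳ-≤ 30 (∑-mono-≤ kinds (λ k → ∑window≤∑box {m} {n} (λ p → ⟦ X k p ⟧))) ⟩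
    30 * ∑[ k ∈ kinds ] ∑box M N (λ p → ⟦ X k p ⟧)
      ≡⟨ cong (30 *_) (sym (∑box-∑ M N kinds (λ k p → ⟦ X k p ⟧))) ⟩
    30 * ∑box M N (λ p → ∑[ k ∈ kinds ] ⟦ X k p ⟧)
      ≡⟨ *-distribˡ-∑box M N 30 (λ p → ∑[ k ∈ kinds ] ⟦ X k p ⟧) ⟩
    ∑box M N (λ p → 30 * ∑[ k ∈ kinds ] ⟦ X k p ⟧)
      ≤⟨ ∑box-mono-≤ M N (λ p → ≤-trans (≤-reflexive (*-distribˡ-∑ 30 kinds (λ k → ⟦ X k p ⟧)))
                                         (∑-mono-≤ kinds (λ k → 30·selected≤sent S half-dependent k p))) ⟩
    ∑box M N (λ p → ∑[ k ∈ kinds ] sent X k p)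
      ≡⟨ ∑box-∑nbr M N (λ k k′ o p → charge k k′ (X k p) (X k′ (p ⊕ o))) ⟩
    total
      ≤⟨ total-≤ ⟩
    114 * (M * N) ∎
    where
    open ≤-Reasoning
    M = 2 + m
    N = 2 + n
    X = configuration S
    open Discharging X M N configuration-off-centre

boundary-absorbed : ∀ k m n → 6 * suc k ≤ m → 6 * suc k ≤ n →
                    suc k * (114 * ((2 + m) * (2 + n))) ≤ (19 * suc k + 30) * (6 * (m * n))
boundary-absorbed k m n 6K≤m 6K≤n = begin
  K * (114 * ((2 + m) * (2 + n)))
    ≡⟨ expand K m n ⟩
  114 * K * (m * n) + 38 * (6 * K * m + 6 * K * n + 2 * (6 * K * 1))
    ≤⟨ +-monoʳ-≤ (114 * K * (m * n)) (*-monoʳ-≤ 38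
         (+-mono-≤ (+-mono-≤ (*-monoˡ-≤ m 6K≤n) (*-monoˡ-≤ n 6K≤m))
                   (*-monoʳ-≤ 2 (*-mono-≤ 6K≤m (≤-trans (s≤s z≤n) 6K≤n))))) ⟩
  114 * K * (m * n) + 38 * (n * m + m * n + 2 * (m * n))
    ≡⟨ collect K m n ⟩
  114 * K * (m * n) + 152 * (m * n)
    ≤⟨ +-monoʳ-≤ (114 * K * (m * n)) (*-monoˡ-≤ (m * n) (m≤m+n 152 28)) ⟩
  114 * K * (m * n) + 180 * (m * n)
    ≡⟨ factor K m n ⟩
  (19 * K + 30) * (6 * (m * n)) ∎
  where
  open ≤-Reasoning
  K = suc k
  expand : ∀ K m n → K * (114 * ((2 + m) * (2 + n)))
                     ≡ 114 * K * (m * n) + 38 * (6 * K * m + 6 * K * n + 2 * (6 * K * 1))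
  expand = solve-∀
  collect : ∀ K m n → 114 * K * (m * n) + 38 * (n * m + m * n + 2 * (m * n)) ≡ 114 * K * (m * n) + 152 * (m * n)
  collect = solve-∀
  factor : ∀ K m n → 114 * K * (m * n) + 180 * (m * n) ≡ (19 * K + 30) * (6 * (m * n))
  factor = solve-∀

theorem3p2 : (k : ℕ) → Σ ℕ λ K → (m n : ℕ) → K ≤ m → K ≤ n →
    (S : Vertex m n → Bool) → HalfDependent S →
    30 * suc k * count S ≤ (19 * suc k + 30) * length (vertices m n)
theorem3p2 k = 6 * suc k , λ m n 6K≤m 6K≤n S half-dependent → begin
  30 * suc k * count S                       ≡⟨ cong (_* count S) (*-comm 30 (suc k)) ⟩
  suc k * 30 * count S                       ≡⟨ *-assoc (suc k) 30 (count S) ⟩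
  suc k * (30 * count S)                     ≤⟨ *-monoʳ-≤ (suc k) (density-bound S half-dependent) ⟩
  suc k * (114 * ((2 + m) * (2 + n)))        ≤⟨ boundary-absorbed k m n 6K≤m 6K≤n ⟩
  (19 * suc k + 30) * (6 * (m * n))          ≡⟨ cong ((19 * suc k + 30) *_) (sym (length-vertices m n)) ⟩
  (19 * suc k + 30) * length (vertices m n)  ∎
  where open ≤-Reasoning
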